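{- Let $d\ge 1$, $r\ge 2$, let $e_1,\dots,e_{r-1}\ge 2$ be integers with $\sum_{j=1}^{r-1}(e_j-1)=d-1$, let $\tau\in S_d$ be a $d$-cycle, let $S=\{s_1<\cdots<s_{r-1}\}$ be a set of integers disjoint from $\{0,1,\dots,d\}$, let $(\sigma_1,\dots,\sigma_{r-1})$ be a factorization of $\tau$ of type $(e_1,\dots,e_{r-1})$, and let $G$ be its factorization graph (which is a tree). Deleting $s_{r-1}$ and its incident edges from $G$ yields trees $Q_1,\dots,Q_k,Q_{k+1},\dots,Q_{e_{r-1}}$, indexed so that for $1\le i\le k$ the set of $[d]$-vertices of $Q_i$ has size $m_i\ge 2$, and for $k+1\le i\le e_{r-1}$ the tree $Q_i$ consists of a single $[d]$-vertex. For $1\le i\le k$ let $B_i=\{j: s_j\text{ is a vertex of }Q_i\}$. Then $\{B_1,\dots,B_k\}$ is a partition of $[r-2]=\{1,\dots,r-2\}$. For $1\le i\le k$ let $\gamma_i=\prod_{j\in B_i}\sigma_j$ (product taken in increasing order of $j$), and for $k+1\le i\le e_{r-1}$ let $\gamma_i$ be the $1$-cycle consisting of the unique $[d]$-vertex of $Q_i$. Then: (i) $\gamma_1\cdots\gamma_k\gamma_{k+1}\cdots\gamma_{e_{r-1}}$ is the cycle decomposition (including $1$-cycles) of $\sigma_1\cdots\sigma_{r-2}=\tau\sigma_{r-1}^{ -1}$; (ii) each $\gamma_i$ is an $m_i$-cycle on the set of $[d]$-vertices of $Q_i$; (iii) for $1\le i\le k$, $(\sigma_j)_{j\in B_i}$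 (in increasing order of $j$) is a factorization of $\gamma_i$, and $Q_i$ is the factorization graph associated to this factorization; (iv) for $1\le i\le k$, $\sum_{j\in B_i}(e_j-1)=m_i-1$.
   Context: $[d]=\{1,\dots,d\}$. An $e$-cycle ($e\ge 2$) is a permutation of cycle type $(e,1,\dots,1)$; permutations compose right-to-left. For a cycle $\gamma$, a factorization of $\gamma$ of type $(e_1,\dots,e_{m})$ is a tuple $(\sigma_1,\dots,\sigma_m)$ of permutations of $\mathrm{supp}(\gamma)$, each $\sigma_i$ an $e_i$-cycle, with $\sigma_1\cdots\sigma_m=\gamma$. Its factorization graph (with respect to an indexing set $\{s_j\}$ of labels disjoint from the points) has vertex set $\{s_j\}\cup\mathrm{supp}(\gamma)$ and edges $\{s_j,\nu\}$ for $\nu\in\mathrm{supp}(\sigma_j)$. Vertices of $G$ in $S$ are called $S$-vertices, the others $[d]$-vertices. -}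

module Defs where

open import Level using (0ℓ)
open import Data.Nat using (ℕ; zero; suc; _<_)
open import Data.Fin using (Fin)
open import Data.Fin.Permutation using (Permutation′; _⟨$⟩ʳ_; _⟨$⟩ˡ_; _∘ₚ_)
import Data.Fin.Permutation as P
open import Data.List using (List; []; _∷_; map)
open import Data.List.Relation.Unary.All using (All)
open import Data.List.Membership.Propositional using (_∈_)
open import Data.Product using (Σ; ∃; _×_; _,_)
open import Data.Sum using (_⊎_; inj₁; inj₂)
open import Data.Empty using (⊥)
open import Relation.Nullary using (¬_)
open import Relation.Binary.PropositionalEquality using (_≡_; _≢_)
open import Relation.Binary.Construct.Closure.ReflexiveTransitive using (Star)
open import Function.Bundles using (_⇔_)
open import Function.Definitions using (Injective)

-- Permutations of [d], represented as Fin d (points 0..d-1 stand for 1..d).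

Perm : ℕ → Set
Perm d = Permutation′ d

app : ∀ {d} → Perm d → Fin d → Fin d
app σ x = σ ⟨$⟩ʳ x

appInv : ∀ {d} → Perm d → Fin d → Fin d
appInv σ x = σ ⟨$⟩ˡ x

-- product, composing right-to-left:  app (σ · τ) x = app σ (app τ x)
_·_ : ∀ {d} → Perm d → Perm d → Perm d
σ · τ = τ ∘ₚ σ

prodL : ∀ {d} → List (Perm d) → Perm d
prodL []       = P.id
prodL (σ ∷ σs) = σ · prodL σs

iter : ∀ {d} → Perm d → ℕ → Fin d → Fin d
iter σ zero    x = x
iter σ (suc i) x = app σ (iter σ i x)

Supp : ∀ {d} → Perm d → Fin d → Set
Supp σ x = app σ x ≢ x

-- σ is an m-cycle on the set A (A may be a singleton, giving a 1-cycle):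
-- some x ∈ A has orbit x, σx, …, σ^(m-1)x of exactly m distinct points,
-- this orbit is exactly A, and σ fixes every point outside A.
IsCycleOn : ∀ {d} → ℕ → Perm d → (Fin d → Set) → Set
IsCycleOn {d} m σ A =
  Σ (Fin d) λ x →
    A x
  × iter σ m x ≡ x
  × (∀ i j → i < j → j < m → iter σ i x ≢ iter σ j x)
  × (∀ i → i < m → A (iter σ i x))
  × (∀ y → A y → ∃ λ i → i < m × y ≡ iter σ i x)
  × (∀ y → ¬ A y → app σ y ≡ y)

IsECycle : ∀ {d} → ℕ → Perm d → Set
IsECycle e σ = IsCycleOn e σ (Supp σ)

HasSize : ∀ {d} → (Fin d → Set) → ℕ → Set
HasSize {d} A m =
  Σ (Fin m → Fin d) λ f → Injective _≡_ _≡_ f × (∀ y → A y ⇔ (∃ λ i → f i ≡ y))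

-- (σ₁,…,σₘ) with prescribed lengths (e₁,…,eₘ) is a factorization of γ of
-- type (e₁,…,eₘ): each σᵢ is an eᵢ-cycle permuting supp(γ) (i.e. its
-- support lies in supp(γ)), and σ₁⋯σₘ = γ.
IsFactorization : ∀ {d} → Perm d → List (Perm d × ℕ) → Set
IsFactorization {d} γ fs =
    All (λ { (σ , e) → IsECycle e σ × (∀ y → Supp σ y → Supp γ y) }) fs
  × (∀ x → app (prodL (map (λ { (σ , e) → σ }) fs)) x ≡ app γ x)

-- Bipartite graphs whose vertices are labels (Fin k, standing for the
-- S-vertices s_j) and points (Fin d, the [d]-vertices).  Every edge joins
-- a label and a point.

record BGraph (k d : ℕ) : Set₁ where
  field
    SV   : Fin k → Set
    PV   : Fin d → Set
    Edge : Fin k → Fin d → Set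
open BGraph public

Vertex : ℕ → ℕ → Set
Vertex k d = Fin k ⊎ Fin d

Vtx : ∀ {k d} → BGraph k d → Vertex k d → Set
Vtx G (inj₁ j) = SV G j
Vtx G (inj₂ x) = PV G x

Adj : ∀ {k d} → BGraph k d → Vertex k d → Vertex k d → Set
Adj G (inj₁ j) (inj₂ x) = Edge G j x
Adj G (inj₂ x) (inj₁ j) = Edge G j x
Adj G (inj₁ _) (inj₁ _) = ⊥
Adj G (inj₂ _) (inj₂ _) = ⊥

Conn : ∀ {k d} → BGraph k d → Vertex k d → Vertex k d → Set
Conn G = Star (Adj G)

FactGraph : ∀ {k d} → (Fin k → Perm d) → (Fin k → Set) → Perm d → BGraph k d
FactGraph σ I γ = record
  { SV   = I
  ; PV   = Supp γ
  ; Edge = λ j x → I j × Supp (σ j) x }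

DeleteLabel : ∀ {k d} → BGraph k d → Fin k → BGraph k d
DeleteLabel G l = record
  { SV   = λ j → SV G j × j ≢ l
  ; PV   = PV G
  ; Edge = λ j x → Edge G j x × j ≢ l }

Induced : ∀ {k d} → BGraph k d → (Vertex k d → Set) → BGraph k d
Induced G C = record
  { SV   = λ j → SV G j × C (inj₁ j)
  ; PV   = λ x → PV G x × C (inj₂ x)
  ; Edge = λ j x → Edge G j x × C (inj₁ j) × C (inj₂ x) }

Component : ∀ {k d} → BGraph k d → Vertex k d → BGraph k d
Component G v = Induced G (Conn G v)

SameGraph : ∀ {k d} → BGraph k d → BGraph k d → Set
SameGraph G H =
    (∀ j → SV G j ⇔ SV H j)
  × (∀ x → PV G x ⇔ PV H x)
  × (∀ j x → Edge G j x ⇔ Edge H j x)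

-- Let π = σ₁⋯σ_{r-2} = τσ_{r-1}⁻¹ and let ≈ be connectedness of points in G′. Every
-- point x satisfies x ≈ πx, and off supp σ_{r-1} the map π agrees with the d-cycle τ,
-- so every component of G′ meets supp σ_{r-1}. Computing the components by merging
-- the supports of σ₁, …, σ_{r-2} one at a time, a support of size e_j lowers the
-- number of classes inside any union of components by at most e_j − 1. For the
-- component C of ν ∈ supp σ_{r-1} and for its complement these bounds add up to
-- exactly d = Σ_j (e_j − 1) + 1, so C meets supp σ_{r-1} only in ν and has
-- 1 + Σ_{j∈B} (e_j − 1) points. Hence C is the π-orbit of ν, on which π agrees with
-- γ = ∏_{j∈B} σ_j, while γ fixes every point outside C.

module Submission where

open import Defs
open import Level using (0ℓ)
open import Data.Bool using (if_then_else_)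
open import Data.Nat using (ℕ; zero; suc; _+_; _∸_; _≤_; _<_; z≤n; s≤s)
open import Data.Nat.Properties
  using ( ≤-antisym; ≤-trans; ≤-refl; ≤-reflexive; ≤-pred; <-trans; ≤-<-trans; <⇒≤; <-cmp; _≤?_
        ; n≤0⇒n≡0; n<1⇒n≡0; n<1+n; m≤n⇒m<n∨m≡n; m+[n∸m]≡n; m∸n+n≡m; m<n⇒0<n∸m; m∸n≤m; ∸-monoʳ-<
        ; +-comm; +-suc; +-assoc; +-identityʳ; +-cancelˡ-≡; +-cancelʳ-≤; +-mono-≤; +-monoˡ-≤; +-monoʳ-≤
        ; +-commutativeSemigroup; module ≤-Reasoning )
open import Data.Nat.ListAction using (sum)
open import Data.Nat.ListAction.Properties using (sum-++)
open import Data.Nat.Tactic.RingSolver using (solve-∀)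
open import Algebra.Properties.CommutativeSemigroup +-commutativeSemigroup using (x∙yz≈y∙xz; xy∙z≈x∙zy)
open import Data.Fin using (Fin; fromℕ; inject₁; toℕ; fromℕ<; lower₁)
import Data.Fin as F
open import Data.Fin.Properties
  using ( _≟_; any?; ¬∀⟶∃¬-smallest; pigeonhole; injective⇒≤; toℕ<n; toℕ-injective
        ; toℕ-fromℕ; toℕ-fromℕ<; toℕ-inject; toℕ-inject₁; fromℕ≢inject₁; inject₁-lower₁ )
import Data.Fin.Properties as FP
open import Data.Fin.Permutation using (inverseˡ; inverseʳ)
open import Data.List using (List; []; _∷_; _++_; map; tabulate; length; lookup; filter; allFin)
open import Data.List.Properties using (filter-some; map-tabulate; map-cong; map-∘)
open import Data.List.Membership.Propositional using (_∈_)
open import Data.List.Membership.Propositional.Properties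
  using (∈-filter⁺; ∈-filter⁻; ∈-allFin; ∈-lookup; ∈-tabulate⁺)
open import Data.List.Relation.Unary.Any using (here; there; index)
import Data.List.Relation.Unary.Any as Any
open import Data.List.Relation.Unary.Any.Properties using (lookup-index)
open import Data.List.Relation.Unary.All using (All; []; _∷_)
import Data.List.Relation.Unary.All as All
import Data.List.Relation.Unary.All.Properties as AllP
open import Data.List.Relation.Unary.AllPairs using (AllPairs; _∷_)
import Data.List.Relation.Unary.AllPairs.Properties as AllPairsP
open import Data.List.Relation.Unary.Linked using (Linked)
open import Data.List.Relation.Unary.Linked.Properties using (Linked⇒AllPairs)
open import Data.List.Relation.Unary.Unique.Propositional using (Unique)
import Data.List.Relation.Unary.Unique.Propositional.Properties as Unique
open import Data.Unit using (⊤; tt)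
open import Data.Sum using (_⊎_; inj₁; inj₂)
open import Data.Product using (Σ; ∃; _×_; _,_; proj₁; proj₂)
open import Function.Base using (_∘_; case_of_)
open import Function.Bundles using (_⇔_; mk⇔; Equivalence)
import Function.Properties.Equivalence as ⇔
open import Relation.Nullary using (¬_; yes; no; does; ¬?; contradiction)
open import Relation.Nullary.Decidable using (decidable-stable; _×-dec_)
open import Relation.Unary using (Pred; Decidable; _⊆_; _≐_; _∩_; ∁)
open import Relation.Unary.Properties using (U?; ∁?; _∩?_)
open import Relation.Binary using (Rel; IsEquivalence; Irreflexive; Asymmetric; tri<; tri≈; tri>)
open import Relation.Binary.PropositionalEquality
open import Relation.Binary.Construct.Closure.ReflexiveTransitive using (ε; _◅_; _◅◅_)
import Relation.Binary.Construct.Closure.ReflexiveTransitive as Star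

lookup-injective : ∀ {A : Set} {xs : List A} → Unique xs →
                   ∀ {i j} → lookup xs i ≡ lookup xs j → i ≡ j
lookup-injective (_   ∷ _) {F.zero}  {F.zero}  _  = refl
lookup-injective (x∉ ∷ _) {F.zero}  {F.suc j} eq = contradiction eq (All.lookup x∉ (∈-lookup j))
lookup-injective (x∉ ∷ _) {F.suc i} {F.zero}  eq = contradiction (sym eq) (All.lookup x∉ (∈-lookup i))
lookup-injective (_   ∷ u) {F.suc i} {F.suc j} eq = cong F.suc (lookup-injective u eq)

tabulate-init-last : ∀ {A : Set} n (f : Fin (suc n) → A) →
                     tabulate f ≡ tabulate (f ∘ inject₁) ++ f (fromℕ n) ∷ []
tabulate-init-last zero    f = refl
tabulate-init-last (suc n) f = cong (f F.zero ∷_) (tabulate-init-last n (f ∘ F.suc))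

module _ {A : Set} {P Q : Pred A 0ℓ} (P? : Decidable P) (Q? : Decidable Q) where

  length-filter-split : ∀ xs →
    length (filter P? xs) ≡ length (filter (P? ∩? Q?) xs) + length (filter (P? ∩? ∁? Q?) xs)
  length-filter-split [] = refl
  length-filter-split (x ∷ xs) with P? x | Q? x
  ... | yes _ | yes _ = cong suc (length-filter-split xs)
  ... | yes _ | no _  = trans (cong suc (length-filter-split xs))
                             (sym (+-suc (length (filter (P? ∩? Q?) xs)) _))
  ... | no _  | _     = length-filter-split xs

module _ {A : Set} {P : Pred A 0ℓ} (P? : Decidable P) (f : A → ℕ) where

  sum-filter-split : ∀ xs → sum (map f (filter P? xs)) + sum (map f (filter (∁? P?) xs)) ≡ sum (map f xs)
  sum-filter-split [] = refl
  sum-filter-split (x ∷ xs) with P? x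
  ... | yes _ = trans (+-assoc (f x) _ _) (cong (f x +_) (sum-filter-split xs))
  ... | no _  = trans (x∙yz≈y∙xz (sum (map f (filter P? xs))) (f x) _) (cong (f x +_) (sum-filter-split xs))

module _ {A : Set} {_<_ : Rel A 0ℓ} (<-irrefl : Irreflexive _≡_ _<_) (<-asym : Asymmetric _<_) where

  sorted-unique : ∀ {xs ys} → AllPairs _<_ xs → AllPairs _<_ ys →
                  (∀ z → z ∈ xs → z ∈ ys) → (∀ z → z ∈ ys → z ∈ xs) → xs ≡ ys
  sorted-unique {[]}     {[]}     _ _ _ _ = refl
  sorted-unique {[]}     {y ∷ _}  _ _ _ ⊇ with () ← ⊇ y (here refl)
  sorted-unique {x ∷ _}  {[]}     _ _ ⊆ _ with () ← ⊆ x (here refl)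
  sorted-unique {x ∷ xs} {y ∷ ys} (x< ∷ <xs) (y< ∷ <ys) ⊆ ⊇ = cong₂ _∷_ x≡y (sorted-unique <xs <ys ⊆′ ⊇′)
    where
    x≡y : x ≡ y
    x≡y with ⊆ x (here refl) | ⊇ y (here refl)
    ... | here x≡y   | _          = x≡y
    ... | there _    | here y≡x   = sym y≡x
    ... | there x∈ys | there y∈xs = contradiction (All.lookup y< x∈ys) (<-asym (All.lookup x< y∈xs))
    ⊆′ : ∀ z → z ∈ xs → z ∈ ys
    ⊆′ z z∈xs with ⊆ z (there z∈xs)
    ... | here refl = contradiction (All.lookup x< z∈xs) (<-irrefl x≡y)
    ... | there z∈ys = z∈ys
    ⊇′ : ∀ z → z ∈ ys → z ∈ xs
    ⊇′ z z∈ys with ⊇ z (there z∈ys)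
    ... | here refl = contradiction (All.lookup y< z∈ys) (<-irrefl (sym x≡y))
    ... | there z∈xs = z∈xs

-- Counting points of Fin d

module _ {d : ℕ} where

  count : {P : Pred (Fin d) 0ℓ} → Decidable P → ℕ
  count P? = length (filter P? (allFin d))

  enumeration : {P : Pred (Fin d) 0ℓ} (P? : Decidable P) → HasSize P (count P?)
  enumeration P? = lookup xs , lookup-injective (Unique.filter⁺ P? (Unique.allFin⁺ d)) ,
                   λ y → mk⇔ (λ p → let y∈ = ∈-filter⁺ P? (∈-allFin y) p in index y∈ , sym (lookup-index y∈))
                              λ { (i , refl) → proj₂ (∈-filter⁻ P? {xs = allFin d} (∈-lookup i)) }
    where xs = filter P? (allFin d)

  HasSize-≤ : ∀ {P Q : Pred (Fin d) 0ℓ} {m n} → HasSize P m → HasSize Q n →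
    (h : ∀ {x} → P x → Fin d) → (∀ {x} (p : P x) → Q (h p)) →
    (∀ {x y} (p : P x) (q : P y) → h p ≡ h q → x ≡ y) → m ≤ n
  HasSize-≤ {P} {Q} (f , f-inj , f-spec) (g , _ , g-spec) h h-in h-inj = injective⇒≤ H-inj
    where
    P-f : ∀ i → P (f i)
    P-f i = Equivalence.from (f-spec (f i)) (i , refl)
    index-in-Q : ∀ i → ∃ λ k → g k ≡ h (P-f i)
    index-in-Q i = Equivalence.to (g-spec _) (h-in (P-f i))
    H : Fin _ → Fin _
    H i = proj₁ (index-in-Q i)
    H-inj : ∀ {i j} → H i ≡ H j → i ≡ j
    H-inj {i} {j} eq = f-inj (h-inj (P-f i) (P-f j)
      (trans (sym (proj₂ (index-in-Q i))) (trans (cong g eq) (proj₂ (index-in-Q j)))))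

  module _ {P Q : Pred (Fin d) 0ℓ} (P? : Decidable P) (Q? : Decidable Q) where

    count-injection : (h : ∀ {x} → P x → Fin d) → (∀ {x} (p : P x) → Q (h p)) →
      (∀ {x y} (p : P x) (q : P y) → h p ≡ h q → x ≡ y) → count P? ≤ count Q?
    count-injection = HasSize-≤ (enumeration P?) (enumeration Q?)

    count-mono : P ⊆ Q → count P? ≤ count Q?
    count-mono P⊆Q = count-injection (λ {x} _ → x) P⊆Q (λ _ _ eq → eq)

    count-split : count P? ≡ count (P? ∩? Q?) + count (P? ∩? ∁? Q?)
    count-split = length-filter-split P? Q? (allFin d)

  count-≐ : ∀ {P Q : Pred (Fin d) 0ℓ} (P? : Decidable P) (Q? : Decidable Q) → P ≐ Q → count P? ≡ count Q?
  count-≐ P? Q? (P⊆Q , Q⊆P) = ≤-antisym (count-mono P? Q? P⊆Q) (count-mono Q? P? Q⊆P)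

  module _ {P : Pred (Fin d) 0ℓ} (P? : Decidable P) where

    count-HasSize : ∀ {m} → HasSize P m → count P? ≡ m
    count-HasSize size = ≤-antisym (HasSize-≤ (enumeration P?) size (λ {x} _ → x) (λ p → p) (λ _ _ eq → eq))
                                   (HasSize-≤ size (enumeration P?) (λ {x} _ → x) (λ p → p) (λ _ _ eq → eq))

    count-pos : ∀ {x} → P x → 1 ≤ count P?
    count-pos {x} p = filter-some P? (Any.map (λ { refl → p }) (∈-allFin x))

    count≤1⇒unique : count P? ≤ 1 → ∀ {x y} → P x → P y → x ≡ y
    count≤1⇒unique c≤1 {x} {y} px py = trans (sym fi≡x) (trans (cong f i≡j) fj≡y)
      where
      f = proj₁ (enumeration P?)
      enumerates = proj₂ (proj₂ (enumeration P?))
      i = proj₁ (Equivalence.to (enumerates x) px)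
      fi≡x = proj₂ (Equivalence.to (enumerates x) px)
      j = proj₁ (Equivalence.to (enumerates y) py)
      fj≡y = proj₂ (Equivalence.to (enumerates y) py)
      only-zero : (k : Fin (count P?)) → toℕ k ≡ 0
      only-zero k = n≤0⇒n≡0 (≤-pred (≤-trans (toℕ<n k) c≤1))
      i≡j : i ≡ j
      i≡j = toℕ-injective (trans (only-zero i) (sym (only-zero j)))

  count-all : count (U? {A = Fin d}) ≡ d
  count-all = count-HasSize U? ((λ x → x) , (λ eq → eq) , λ y → mk⇔ (λ _ → y , refl) _)

  count-complement : ∀ {P : Pred (Fin d) 0ℓ} (P? : Decidable P) → count P? + count (∁? P?) ≡ d
  count-complement P? = begin
    count P? + count (∁? P?)                 ≡⟨ cong₂ _+_ (count-≐ P? (U? ∩? P?) U∩-≐)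
                                                         (count-≐ (∁? P?) (U? ∩? ∁? P?) U∩-≐) ⟩
    count (U? ∩? P?) + count (U? ∩? ∁? P?)   ≡⟨ count-split U? P? ⟨
    count (U? {A = Fin d})                   ≡⟨ count-all ⟩
    d                                        ∎
    where
    open ≡-Reasoning
    U∩-≐ : ∀ {A : Pred (Fin d) 0ℓ} → A ≐ (λ x → ⊤ × A x)
    U∩-≐ = (λ a → _ , a) , proj₂

  count-singleton : ∀ c → count (_≟ c) ≡ 1
  count-singleton c = count-HasSize (_≟ c) ((λ _ → c) , (λ { {F.zero} {F.zero} _ → refl }) ,
                                            λ y → mk⇔ (λ y≡c → F.zero , sym y≡c) λ { (_ , refl) → refl })

  HasSize-full : ∀ {A : Pred (Fin d) 0ℓ} (A? : Decidable A) → HasSize A d → ∀ x → A x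
  HasSize-full A? size x = decidable-stable (A? x) λ x∉A →
    case ≤-trans (count-pos (∁? A?) x∉A) (≤-reflexive outside-empty) of λ ()
    where
    outside-empty : count (∁? A?) ≡ 0
    outside-empty = +-cancelˡ-≡ d _ 0 (trans (cong (_+ count (∁? A?)) (sym (count-HasSize A? size)))
                                             (trans (count-complement A?) (sym (+-identityʳ d))))

counting-squeeze : ∀ {c c̄ s s̄ a ā} → c ≤ 1 + s → c̄ ≤ ā + s̄ → 1 ≤ a →
                   c + c̄ ≡ (s + s̄) + (a + ā) → a ≡ 1 × c ≡ 1 + s
counting-squeeze {c} {c̄} {s} {s̄} {a} {ā} c≤ c̄≤ 1≤a total = a≡1 , ≤-antisym c≤ 1+s≤c
  where
  rearrange₁ : ∀ s s̄ a ā → s + s̄ + (a + ā) ≡ a + (s + s̄ + ā)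
  rearrange₁ = solve-∀
  rearrange₂ : ∀ s s̄ ā → 1 + s + (ā + s̄) ≡ 1 + (s + s̄ + ā)
  rearrange₂ = solve-∀
  rest = s + s̄ + ā
  bound : a + rest ≤ 1 + rest
  bound = begin
    a + rest          ≡⟨ rearrange₁ s s̄ a ā ⟨
    s + s̄ + (a + ā)   ≡⟨ total ⟨
    c + c̄             ≤⟨ +-mono-≤ c≤ c̄≤ ⟩
    1 + s + (ā + s̄)   ≡⟨ rearrange₂ s s̄ ā ⟩
    1 + rest          ∎
    where open ≤-Reasoning
  a≡1 : a ≡ 1
  a≡1 = ≤-antisym (+-cancelʳ-≤ rest a 1 bound) 1≤a
  1+s≤c : 1 + s ≤ c
  1+s≤c = +-cancelʳ-≤ (ā + s̄) (1 + s) c (begin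
    1 + s + (ā + s̄)   ≡⟨ rearrange₂ s s̄ ā ⟩
    1 + rest          ≡⟨ cong (_+ rest) a≡1 ⟨
    a + rest          ≡⟨ rearrange₁ s s̄ a ā ⟨
    s + s̄ + (a + ā)   ≡⟨ total ⟨
    c + c̄             ≤⟨ +-monoʳ-≤ c c̄≤ ⟩
    c + (ā + s̄)       ∎)
    where open ≤-Reasoning

-- Permutations and orbits

least : ∀ {Q : Pred ℕ 0ℓ} → Decidable Q → ∀ {K} → Q K →
        ∃ λ k → Q k × (∀ {k′} → k′ < k → ¬ Q k′)
least {Q} Q? {K} qK
  with i , ¬¬qi , below ← ¬∀⟶∃¬-smallest (suc K) (λ i → ¬ Q (toℕ i)) (λ i → ¬? (Q? (toℕ i)))
                            (λ ∀¬Q → ∀¬Q (fromℕ K) (subst Q (sym (toℕ-fromℕ K)) qK))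
  = toℕ i , decidable-stable (Q? (toℕ i)) ¬¬qi ,
    λ k′<i → subst (λ k → ¬ Q k) (trans (toℕ-inject (fromℕ< k′<i)) (toℕ-fromℕ< k′<i))
                   (below (fromℕ< k′<i))

module _ {d : ℕ} where

  app-injective : (σ : Perm d) → ∀ {x y} → app σ x ≡ app σ y → x ≡ y
  app-injective σ eq = trans (sym (inverseˡ σ)) (trans (cong (appInv σ) eq) (inverseˡ σ))

  supp? : (σ : Perm d) → Decidable (Supp σ)
  supp? σ x = ¬? (app σ x ≟ x)

  ¬Supp⇒fixed : (σ : Perm d) → ∀ {x} → ¬ Supp σ x → app σ x ≡ x
  ¬Supp⇒fixed σ {x} = decidable-stable (app σ x ≟ x)

  Supp-app : (σ : Perm d) → ∀ {x} → Supp σ x → Supp σ (app σ x)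
  Supp-app σ x∈ = x∈ ∘ app-injective σ

  prodL-++ : (σs τs : List (Perm d)) → ∀ x → app (prodL (σs ++ τs)) x ≡ app (prodL σs) (app (prodL τs) x)
  prodL-++ []       τs x = refl
  prodL-++ (σ ∷ σs) τs x = cong (app σ) (prodL-++ σs τs x)

  prodL-fixes : ∀ (σs : List (Perm d)) {y} → All (λ σ → app σ y ≡ y) σs → app (prodL σs) y ≡ y
  prodL-fixes []       []             = refl
  prodL-fixes (σ ∷ σs) (σy≡y ∷ fixes) = trans (cong (app σ) (prodL-fixes σs fixes)) σy≡y

  module _ (ρ : Perm d) where

    iter-+ : ∀ i k x → iter ρ (i + k) x ≡ iter ρ i (iter ρ k x)
    iter-+ zero    k x = refl
    iter-+ (suc i) k x = cong (app ρ) (iter-+ i k x)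

    iter-suc-app : ∀ i x → iter ρ (suc i) x ≡ iter ρ i (app ρ x)
    iter-suc-app i x = trans (cong (λ k → iter ρ k x) (+-comm 1 i)) (iter-+ i 1 x)

    iter-injective : ∀ i {x y} → iter ρ i x ≡ iter ρ i y → x ≡ y
    iter-injective zero    eq = eq
    iter-injective (suc i) eq = iter-injective i (app-injective ρ eq)

    record IsPeriod (x : Fin d) (m : ℕ) : Set where
      field
        positive : 1 ≤ m
        returns  : iter ρ m x ≡ x
        minimal  : ∀ {k} → 1 ≤ k → k < m → iter ρ k x ≢ x

    Returns : Fin d → ℕ → Set
    Returns x k = 1 ≤ k × iter ρ k x ≡ x

    returns? : ∀ x → Decidable (Returns x)
    returns? x k = (1 ≤? k) ×-dec (iter ρ k x ≟ x)

    returns-eventually : ∀ x → ∃ (Returns x)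
    returns-eventually x
      with i , j , i<j , eq ← pigeonhole (n<1+n d) (λ (i : Fin (suc d)) → iter ρ (toℕ i) x)
      = toℕ j ∸ toℕ i , m<n⇒0<n∸m i<j , iter-injective (toℕ i) (begin
        iter ρ (toℕ i) (iter ρ (toℕ j ∸ toℕ i) x) ≡⟨ iter-+ (toℕ i) _ x ⟨
        iter ρ (toℕ i + (toℕ j ∸ toℕ i)) x       ≡⟨ cong (λ k → iter ρ k x) (m+[n∸m]≡n (<⇒≤ i<j)) ⟩
        iter ρ (toℕ j) x                         ≡⟨ eq ⟨
        iter ρ (toℕ i) x                         ∎)
      where open ≡-Reasoning

    period : ∀ x → ∃ (IsPeriod x)
    period x with k , (1≤k , returns) , below ← least (returns? x) (proj₂ (returns-eventually x))
      = k , record { positive = 1≤k ; returns = returns ; minimal = λ 1≤k′ k′<k q → below k′<k (1≤k′ , q) }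

    module _ {x m} (per : IsPeriod x m) where
      open IsPeriod per

      period-distinct : ∀ {i j} → i < j → j < m → iter ρ i x ≢ iter ρ j x
      period-distinct {i} {j} i<j j<m eq =
        minimal (m<n⇒0<n∸m i<j) (≤-<-trans (m∸n≤m j i) j<m) (iter-injective i (begin
          iter ρ i (iter ρ (j ∸ i) x) ≡⟨ iter-+ i (j ∸ i) x ⟨
          iter ρ (i + (j ∸ i)) x      ≡⟨ cong (λ k → iter ρ k x) (m+[n∸m]≡n (<⇒≤ i<j)) ⟩
          iter ρ j x                  ≡⟨ eq ⟨
          iter ρ i x                  ∎))
        where open ≡-Reasoning

      InOrbit : Fin d → Set
      InOrbit y = ∃ λ i → i < m × y ≡ iter ρ i x

      InOrbit-app⁻ : ∀ {y} → InOrbit (app ρ y) → InOrbit y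
      InOrbit-app⁻ {y} (zero , _ , eq) = m ∸ 1 , m∸1<m , app-injective ρ (begin
        app ρ y                  ≡⟨ eq ⟩
        x                        ≡⟨ returns ⟨
        iter ρ m x               ≡⟨ cong (λ k → iter ρ k x) (m∸n+n≡m positive) ⟨
        iter ρ (m ∸ 1 + 1) x     ≡⟨ cong (λ k → iter ρ k x) (+-comm (m ∸ 1) 1) ⟩
        app ρ (iter ρ (m ∸ 1) x) ∎)
        where
        open ≡-Reasoning
        m∸1<m : m ∸ 1 < m
        m∸1<m = ∸-monoʳ-< {o = 0} ≤-refl positive
      InOrbit-app⁻ (suc i , i<m , eq) = i , <-trans (n<1+n i) i<m , app-injective ρ eq

      InOrbit-iter⁻ : ∀ k {y} → InOrbit (iter ρ k y) → InOrbit y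
      InOrbit-iter⁻ zero    y∈ = y∈
      InOrbit-iter⁻ (suc k) {y} y∈ =
        InOrbit-app⁻ (InOrbit-iter⁻ k (subst InOrbit (iter-suc-app k y) y∈))

  orbit-HasSize : ∀ {A : Pred (Fin d) 0ℓ} m (ρ : Perm d) x →
    (∀ i j → i < j → j < m → iter ρ i x ≢ iter ρ j x) →
    (∀ i → i < m → A (iter ρ i x)) →
    (∀ y → A y → ∃ λ i → i < m × y ≡ iter ρ i x) →
    HasSize A m
  orbit-HasSize m ρ x distinct inside cover =
    (λ i → iter ρ (toℕ i) x) , injective , λ y → mk⇔ (enumerated y) λ { (i , refl) → inside (toℕ i) (toℕ<n i) }
    where
    injective : ∀ {i j : Fin m} → iter ρ (toℕ i) x ≡ iter ρ (toℕ j) x → i ≡ j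
    injective {i} {j} eq with <-cmp (toℕ i) (toℕ j)
    ... | tri< i<j _ _ = contradiction eq (distinct _ _ i<j (toℕ<n j))
    ... | tri≈ _ i≡j _ = toℕ-injective i≡j
    ... | tri> _ _ j<i = contradiction (sym eq) (distinct _ _ j<i (toℕ<n i))
    enumerated : ∀ y → _ → ∃ λ (i : Fin m) → iter ρ (toℕ i) x ≡ y
    enumerated y y∈ with i , i<m , refl ← cover y y∈ = fromℕ< i<m , cong (λ k → iter ρ k x) (toℕ-fromℕ< i<m)

  IsCycleOn⇒HasSize : ∀ {m σ} {A : Pred (Fin d) 0ℓ} → IsCycleOn m σ A → HasSize A m
  IsCycleOn⇒HasSize {m} {σ} (x , _ , _ , distinct , inside , cover , _) = orbit-HasSize m σ x distinct inside cover

  IsCycleOn-connects : ∀ {m σ} {A : Pred (Fin d) 0ℓ} → IsCycleOn m σ A →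
                       ∀ {y z} → A y → A z → ∃ λ k → iter σ k y ≡ z
  IsCycleOn-connects {m} {σ} (x , _ , returns , _ , _ , cover , _) {y} {z} y∈A z∈A
    with i , i<m , refl ← cover y y∈A | j , _ , refl ← cover z z∈A
    = j + (m ∸ i) , (begin
      iter σ (j + (m ∸ i)) (iter σ i x) ≡⟨ iter-+ σ j (m ∸ i) _ ⟩
      iter σ j (iter σ (m ∸ i) (iter σ i x)) ≡⟨ cong (iter σ j) (iter-+ σ (m ∸ i) i x) ⟨
      iter σ j (iter σ (m ∸ i + i) x) ≡⟨ cong (λ k → iter σ j (iter σ k x)) (m∸n+n≡m (<⇒≤ i<m)) ⟩
      iter σ j (iter σ m x) ≡⟨ cong (iter σ j) returns ⟩
      iter σ j x ∎)
    where open ≡-Reasoning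

-- Merging classes

module _ {d : ℕ} where

  Fixed : (Fin d → Fin d) → Pred (Fin d) 0ℓ
  Fixed r x = r x ≡ x

  fixed? : (r : Fin d → Fin d) → Decidable (Fixed r)
  fixed? r x = r x ≟ x

-- A map r : Fin d → Fin d stands for the partition into its fibres, with the fixed points
-- of an idempotent r as class representatives; merge r i is one union–find step, joining
-- every class that meets S i to the class of base i.
module Merging {d : ℕ} {I : Set} {_≈_ : Rel (Fin d) 0ℓ} (≈-isEquivalence : IsEquivalence _≈_)
  {S : I → Pred (Fin d) 0ℓ} (S? : ∀ i → Decidable (S i)) (base : I → Fin d) (base∈S : ∀ i → S i (base i))
  where

  open IsEquivalence ≈-isEquivalence using () renaming (sym to ≈-sym; trans to ≈-trans)
  open import Algebra.Definitions {A = Fin d} _≡_ using (IdempotentFun)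

  Connected : I → Set
  Connected i = ∀ {x y} → S i x → S i y → x ≈ y

  Meets : (Fin d → Fin d) → I → Pred (Fin d) 0ℓ
  Meets r i v = ∃ λ y → S i y × r y ≡ v

  meets? : ∀ r i → Decidable (Meets r i)
  meets? r i v = any? λ y → S? i y ×-dec (r y ≟ v)

  relabel : (Fin d → Fin d) → I → Fin d → Fin d
  relabel r i v = if does (meets? r i v) then r (base i) else v

  merge : (Fin d → Fin d) → I → Fin d → Fin d
  merge r i x = relabel r i (r x)

  module _ (r : Fin d → Fin d) (i : I) where

    relabel-meets : ∀ {v} → Meets r i v → relabel r i v ≡ r (base i)
    relabel-meets {v} m with meets? r i v
    ... | yes _ = refl
    ... | no ¬m = contradiction m ¬m

    relabel-misses : ∀ {v} → ¬ Meets r i v → relabel r i v ≡ v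
    relabel-misses {v} ¬m with meets? r i v
    ... | yes m = contradiction m ¬m
    ... | no _  = refl

    meets-base : Meets r i (r (base i))
    meets-base = base i , base∈S i , refl

    merge-block : ∀ {x y} → S i x → S i y → merge r i x ≡ merge r i y
    merge-block x∈ y∈ = trans (relabel-meets (_ , x∈ , refl)) (sym (relabel-meets (_ , y∈ , refl)))

    merge-idempotent : IdempotentFun r → IdempotentFun (merge r i)
    merge-idempotent idem x with meets? r i (r x)
    ... | yes _ = trans (cong (relabel r i) (idem (base i))) (relabel-meets meets-base)
    ... | no ¬m = trans (cong (relabel r i) (idem x)) (relabel-misses ¬m)

    merge-≈ : Connected i → (∀ x → x ≈ r x) → ∀ x → x ≈ merge r i x
    merge-≈ connected x≈rx x with meets? r i (r x)
    ... | no _ = x≈rx x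
    ... | yes (y , y∈ , ry≡rx) =
      ≈-trans (x≈rx x) (subst (_≈ r (base i)) ry≡rx
        (≈-trans (≈-sym (x≈rx y)) (≈-trans (connected y∈ (base∈S i)) (x≈rx (base i)))))

    module _ {U : Pred (Fin d) 0ℓ} (U? : Decidable U) where

      -- Old representatives met by S i inject into S i, the unmet ones stay representatives,
      -- and r (base i) represents the merged class.
      count-merge-inside : IdempotentFun r → U (r (base i)) →
        count (fixed? r ∩? U?) + 1 ≤ count (fixed? (merge r i) ∩? U?) + count (S? i)
      count-merge-inside idem rb∈U = begin
        count F + 1          ≡⟨ cong (_+ 1) (count-split F (meets? r i)) ⟩
        cA + cB + 1          ≡⟨ +-comm (cA + cB) 1 ⟩
        1 + (cA + cB)        ≡⟨ cong suc (+-comm cA cB) ⟩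
        1 + cB + cA          ≤⟨ +-mono-≤ (+-mono-≤ new-fixed old-unmet) old-met ⟩
        cA′ + cB′ + count (S? i) ≡⟨ cong (_+ count (S? i)) (count-split F′ (meets? r i)) ⟨
        count F′ + count (S? i) ∎
        where
        open ≤-Reasoning
        F  = fixed? r ∩? U?
        F′ = fixed? (merge r i) ∩? U?
        cA  = count (F ∩? meets? r i)
        cB  = count (F ∩? ∁? (meets? r i))
        cA′ = count (F′ ∩? meets? r i)
        cB′ = count (F′ ∩? ∁? (meets? r i))
        old-met : cA ≤ count (S? i)
        old-met = count-injection (F ∩? meets? r i) (S? i) (λ (_ , y , _) → y) (λ (_ , _ , y∈ , _) → y∈)
          λ { (_ , _ , _ , refl) (_ , _ , _ , refl) refl → refl }
        old-unmet : cB ≤ cB′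
        old-unmet = count-mono (F ∩? ∁? (meets? r i)) (F′ ∩? ∁? (meets? r i))
          λ { {x} ((rx≡x , x∈U) , ¬m) → (trans (cong (relabel r i) rx≡x) (relabel-misses ¬m) , x∈U) , ¬m }
        new-fixed : 1 ≤ cA′
        new-fixed = count-pos (F′ ∩? meets? r i)
          ((trans (cong (relabel r i) (idem (base i))) (relabel-meets meets-base) , rb∈U) , meets-base)

      count-merge-outside : (∀ x → U x → U (r x)) → (∀ y → U (r y) → U y) → (∀ y → S i y → ¬ U y) →
        count (fixed? (merge r i) ∩? U?) ≡ count (fixed? r ∩? U?)
      count-merge-outside U-r U-r⁻ S∩U=∅ = count-≐ (fixed? (merge r i) ∩? U?) (fixed? r ∩? U?)
        ( (λ {x} (mx≡x , x∈U) → trans (sym (relabel-misses (misses x∈U))) mx≡x , x∈U)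
        , (λ {x} (rx≡x , x∈U) → trans (relabel-misses (misses x∈U)) rx≡x , x∈U) )
        where
        misses : ∀ {x} → U x → ¬ Meets r i (r x)
        misses x∈U (y , y∈ , ry≡rx) = S∩U=∅ y y∈ (U-r⁻ y (subst U (sym ry≡rx) (U-r _ x∈U)))

  mergeAll : (Fin d → Fin d) → List I → Fin d → Fin d
  mergeAll r []       = r
  mergeAll r (i ∷ is) = mergeAll (merge r i) is

  mergeAll-≈ : ∀ r {is} → All Connected is → (∀ x → x ≈ r x) → ∀ x → x ≈ mergeAll r is x
  mergeAll-≈ r []             x≈rx = x≈rx
  mergeAll-≈ r (conn ∷ conns) x≈rx = mergeAll-≈ (merge r _) conns (merge-≈ r _ conn x≈rx)

  mergeAll-cong : ∀ r is {x y} → r x ≡ r y → mergeAll r is x ≡ mergeAll r is y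
  mergeAll-cong r []       eq = eq
  mergeAll-cong r (i ∷ is) eq = mergeAll-cong (merge r i) is (cong (relabel r i) eq)

  mergeAll-block : ∀ r {is i} → i ∈ is → ∀ {x y} → S i x → S i y → mergeAll r is x ≡ mergeAll r is y
  mergeAll-block r {i ∷ is} (here refl) x∈ y∈ = mergeAll-cong (merge r i) is (merge-block r i x∈ y∈)
  mergeAll-block r {j ∷ is} (there i∈) x∈ y∈ = mergeAll-block (merge r j) i∈ x∈ y∈

  excess : I → ℕ
  excess i = count (S? i) ∸ 1

  count-mergeAll : ∀ {U : Pred (Fin d) 0ℓ} (U? : Decidable U) → (∀ {x y} → x ≈ y → U x → U y) →
    ∀ r {is} → All Connected is → IdempotentFun r → (∀ x → x ≈ r x) →
    count (fixed? r ∩? U?) ≤ count (fixed? (mergeAll r is) ∩? U?) + sum (map excess (filter (U? ∘ base) is))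
  count-mergeAll U? U-resp r [] _ _ = ≤-reflexive (sym (+-identityʳ _))
  count-mergeAll {U} U? U-resp r {i ∷ is} (conn ∷ conns) idem x≈rx with U? (base i)
  ... | yes b∈U = begin
    count (fixed? r ∩? U?)                       ≤⟨ +-cancelʳ-≤ 1 _ _ one-step ⟩
    count (fixed? (merge r i) ∩? U?) + excess i  ≤⟨ +-monoˡ-≤ (excess i) rest-steps ⟩
    final + rest + excess i                      ≡⟨ xy∙z≈x∙zy final rest (excess i) ⟩
    final + (excess i + rest)                    ∎
    where
    open ≤-Reasoning
    final = count (fixed? (mergeAll r (i ∷ is)) ∩? U?)
    rest = sum (map excess (filter (U? ∘ base) is))
    rest-steps = count-mergeAll U? U-resp (merge r i) conns (merge-idempotent r i idem) (merge-≈ r i conn x≈rx)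
    one-step : count (fixed? r ∩? U?) + 1 ≤ count (fixed? (merge r i) ∩? U?) + excess i + 1
    one-step = begin
      count (fixed? r ∩? U?) + 1                        ≤⟨ count-merge-inside r i U? idem (U-resp (x≈rx (base i)) b∈U) ⟩
      count (fixed? (merge r i) ∩? U?) + count (S? i)   ≡⟨ cong (count (fixed? (merge r i) ∩? U?) +_)
                                                                (m∸n+n≡m (count-pos (S? i) (base∈S i))) ⟨
      count (fixed? (merge r i) ∩? U?) + (excess i + 1) ≡⟨ +-assoc (count (fixed? (merge r i) ∩? U?)) (excess i) 1 ⟨
      count (fixed? (merge r i) ∩? U?) + excess i + 1   ∎
  ... | no b∉U = subst (_≤ count (fixed? (mergeAll r (i ∷ is)) ∩? U?) + sum (map excess (filter (U? ∘ base) is)))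
    (count-merge-outside r i U? (λ x → U-resp (x≈rx x)) (λ y → U-resp (≈-sym (x≈rx y)))
                         (λ y y∈ y∈U → b∉U (U-resp (conn y∈ (base∈S i)) y∈U)))
    (count-mergeAll U? U-resp (merge r i) conns (merge-idempotent r i idem) (merge-≈ r i conn x≈rx))

-- The factorization graph with the last label deleted

module LastFactorDeleted (d n : ℕ) (d≥1 : 1 ≤ d) (e : Fin (suc n) → ℕ) (e≥2 : ∀ j → 2 ≤ e j)
  (Σe≡d-1 : sum (tabulate (λ j → e j ∸ 1)) ≡ d ∸ 1)
  (τ : Perm d) (τ-cycle : IsECycle d τ) (σ : Fin (suc n) → Perm d)
  (factorization : IsFactorization τ (tabulate (λ j → σ j , e j))) where

  last : Fin (suc n)
  last = fromℕ n

  G : BGraph (suc n) d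
  G = FactGraph σ (λ _ → ⊤) τ

  G′ : BGraph (suc n) d
  G′ = DeleteLabel G last

  Q : Fin d → BGraph (suc n) d
  Q ν = Component G′ (inj₂ ν)

  π : Perm d
  π = prodL (tabulate (λ (j : Fin n) → σ (inject₁ j)))

  σ-cycle : ∀ j → IsECycle (e j) (σ j)
  σ-cycle j = proj₁ (AllP.tabulate⁻ {f = λ j → σ j , e j} (proj₁ factorization) j)

  base : ∀ j → Fin d
  base j = proj₁ (σ-cycle j)

  base∈supp : ∀ j → Supp (σ j) (base j)
  base∈supp j = proj₁ (proj₂ (σ-cycle j))

  count-supp : ∀ j → count (supp? (σ j)) ≡ e j
  count-supp j = count-HasSize (supp? (σ j)) (IsCycleOn⇒HasSize (σ-cycle j))

  τ-full : ∀ x → Supp τ x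
  τ-full = HasSize-full (supp? τ) (IsCycleOn⇒HasSize τ-cycle)

  τ≡π∘σlast : ∀ x → app τ x ≡ app π (app (σ last) x)
  τ≡π∘σlast x = begin
    app τ x
      ≡⟨ proj₂ factorization x ⟨
    app (prodL (map proj₁ (tabulate (λ j → σ j , e j)))) x
      ≡⟨ cong (λ σs → app (prodL σs) x) (map-tabulate (λ j → σ j , e j) proj₁) ⟩
    app (prodL (tabulate σ)) x
      ≡⟨ cong (λ σs → app (prodL σs) x) (tabulate-init-last n σ) ⟩
    app (prodL (tabulate (σ ∘ inject₁) ++ σ last ∷ [])) x
      ≡⟨ prodL-++ (tabulate (σ ∘ inject₁)) _ x ⟩
    app π (app (σ last) x) ∎
    where open ≡-Reasoning

  π≡τ∘σlast⁻¹ : ∀ x → app π x ≡ app τ (appInv (σ last) x)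
  π≡τ∘σlast⁻¹ x = trans (cong (app π) (sym (inverseʳ (σ last)))) (sym (τ≡π∘σlast (appInv (σ last) x)))

  π≡τ-off-last : ∀ {x} → ¬ Supp (σ last) x → app π x ≡ app τ x
  π≡τ-off-last {x} x∉ = trans (cong (app π) (sym (¬Supp⇒fixed (σ last) x∉))) (sym (τ≡π∘σlast x))

  _≈_ : Rel (Fin d) 0ℓ
  x ≈ y = Conn G′ (inj₂ x) (inj₂ y)

  Adj-sym : ∀ {v w} → Adj G′ v w → Adj G′ w v
  Adj-sym {inj₁ _} {inj₂ _} a = a
  Adj-sym {inj₂ _} {inj₁ _} a = a

  Conn-sym : ∀ {v w} → Conn G′ v w → Conn G′ w v
  Conn-sym = Star.reverse (λ {v} {w} → Adj-sym {v} {w})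

  ≈-isEquivalence : IsEquivalence _≈_
  ≈-isEquivalence = record { refl = ε ; sym = Conn-sym ; trans = _◅◅_ }

  open IsEquivalence ≈-isEquivalence using () renaming (sym to ≈-sym)

  edge : ∀ {j x} → j ≢ last → Supp (σ j) x → Edge G′ j x
  edge j≢last x∈ = (tt , x∈) , j≢last

  ≈-block : ∀ {j x y} → j ≢ last → Supp (σ j) x → Supp (σ j) y → x ≈ y
  ≈-block {j} j≢last x∈ y∈ = _◅_ {j = inj₁ j} (edge j≢last x∈) (edge j≢last y∈ ◅ ε)

  ≈-σ : ∀ {j} → j ≢ last → ∀ x → x ≈ app (σ j) x
  ≈-σ {j} j≢last x with supp? (σ j) x
  ... | yes x∈ = ≈-block j≢last x∈ (Supp-app (σ j) x∈)
  ... | no x∉  = subst (x ≈_) (sym (¬Supp⇒fixed (σ j) x∉)) ε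

  ≈-prodL : ∀ {js} → All (_≢ last) js → ∀ x → x ≈ app (prodL (map σ js)) x
  ≈-prodL []                 x = ε
  ≈-prodL (j≢last ∷ js≢last) x = ≈-prodL js≢last x ◅◅ ≈-σ j≢last _

  nonLast : List (Fin (suc n))
  nonLast = tabulate inject₁

  inject₁≢last : ∀ (j : Fin n) → inject₁ j ≢ last
  inject₁≢last j eq = fromℕ≢inject₁ (sym eq)

  nonLast-≢ : All (_≢ last) nonLast
  nonLast-≢ = AllP.tabulate⁺ inject₁≢last

  ∈nonLast : ∀ {j} → j ≢ last → j ∈ nonLast
  ∈nonLast {j} j≢last = subst (_∈ nonLast) (inject₁-lower₁ j n≢j) (∈-tabulate⁺ (lower₁ j n≢j))
    where
    n≢j : n ≢ toℕ j
    n≢j eq = j≢last (toℕ-injective (trans (sym eq) (sym (toℕ-fromℕ n))))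

  nonLast-sorted : AllPairs F._<_ nonLast
  nonLast-sorted = AllPairsP.tabulate⁺-< λ {i} {j} i<j → subst₂ _<_ (sym (toℕ-inject₁ i)) (sym (toℕ-inject₁ j)) i<j

  π≡prodL-nonLast : ∀ x → app π x ≡ app (prodL (map σ nonLast)) x
  π≡prodL-nonLast x = cong (λ σs → app (prodL σs) x) (sym (map-tabulate inject₁ σ))

  ≈-π : ∀ x → x ≈ app π x
  ≈-π x = subst (x ≈_) (sym (π≡prodL-nonLast x)) (≈-prodL nonLast-≢ x)

  ≈-iter-π : ∀ k x → x ≈ iter π k x
  ≈-iter-π zero    x = ε
  ≈-iter-π (suc k) x = ≈-iter-π k x ◅◅ ≈-π _

  -- Off supp σ_last the map π agrees with τ, whose orbit through x meets supp σ_last.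
  π-reaches-last : ∀ x → ∃ λ k → Supp (σ last) (iter π k x)
  π-reaches-last x = let k , τᵏx≡b = IsCycleOn-connects τ-cycle (τ-full x) (τ-full (base last)) in
    follow k x (subst (Supp (σ last)) (sym τᵏx≡b) (base∈supp last))
    where
    follow : ∀ k x → Supp (σ last) (iter τ k x) → ∃ λ k′ → Supp (σ last) (iter π k′ x)
    follow zero    x x∈ = zero , x∈
    follow (suc k) x τᵏ⁺¹x∈ with supp? (σ last) x
    ... | yes x∈ = zero , x∈
    ... | no x∉ = let k′ , π-hit = follow k (app τ x) (subst (Supp (σ last)) (iter-suc-app τ k x) τᵏ⁺¹x∈) in
      suc k′ , subst (Supp (σ last)) (sym (trans (iter-suc-app π k′ x) (cong (iter π k′) (π≡τ-off-last x∉)))) π-hit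

  reaches-last : ∀ x → ∃ λ ν → Supp (σ last) ν × x ≈ ν
  reaches-last x = let k , π-hit = π-reaches-last x in iter π k x , π-hit , ≈-iter-π k x

  open Merging ≈-isEquivalence (λ j → supp? (σ j)) base base∈supp
    using (Connected; mergeAll; mergeAll-≈; mergeAll-block; excess; count-mergeAll)

  nonLast-connected : All Connected nonLast
  nonLast-connected = All.map (λ j≢last {x} {y} → ≈-block j≢last) nonLast-≢

  rep : Fin d → Fin d
  rep = mergeAll (λ x → x) nonLast

  ≈-rep : ∀ x → x ≈ rep x
  ≈-rep = mergeAll-≈ (λ x → x) nonLast-connected λ _ → ε

  rep≡⇒≈ : ∀ {x y} → rep x ≡ rep y → x ≈ y
  rep≡⇒≈ {x} {y} eq = ≈-rep x ◅◅ subst (_≈ y) (sym eq) (≈-sym (≈-rep y))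

  rep-vertex : Vertex (suc n) d → Fin d
  rep-vertex (inj₁ j) = rep (base j)
  rep-vertex (inj₂ x) = rep x

  Adj⇒rep≡ : ∀ {v w} → Adj G′ v w → rep-vertex v ≡ rep-vertex w
  Adj⇒rep≡ {inj₁ j} {inj₂ x} ((_ , x∈) , j≢last) = mergeAll-block (λ x → x) (∈nonLast j≢last) (base∈supp j) x∈
  Adj⇒rep≡ {inj₂ x} {inj₁ j} ((_ , x∈) , j≢last) = mergeAll-block (λ x → x) (∈nonLast j≢last) x∈ (base∈supp j)

  Conn⇒rep≡ : ∀ {v w} → Conn G′ v w → rep-vertex v ≡ rep-vertex w
  Conn⇒rep≡ ε                        = refl
  Conn⇒rep≡ (_◅_ {i} {u} {w} a c) = trans (Adj⇒rep≡ {i} {u} a) (Conn⇒rep≡ c)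

  excess≡e-1 : ∀ j → excess j ≡ e j ∸ 1
  excess≡e-1 j = cong (_∸ 1) (count-supp j)

  Σexcess-nonLast : sum (map excess nonLast) + e last ≡ d
  Σexcess-nonLast = begin
    sum (map excess nonLast) + e last
      ≡⟨ cong (λ xs → sum xs + e last) (trans (map-cong excess≡e-1 nonLast) (map-tabulate inject₁ w)) ⟩
    sum (tabulate (w ∘ inject₁)) + e last
      ≡⟨ cong (sum (tabulate (w ∘ inject₁)) +_) (m∸n+n≡m (≤-trans (s≤s z≤n) (e≥2 last))) ⟨
    sum (tabulate (w ∘ inject₁)) + (w last + 1)
      ≡⟨ +-assoc (sum (tabulate (w ∘ inject₁))) (w last) 1 ⟨
    sum (tabulate (w ∘ inject₁)) + w last + 1
      ≡⟨ cong (λ k → sum (tabulate (w ∘ inject₁)) + k + 1) (+-identityʳ (w last)) ⟨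
    sum (tabulate (w ∘ inject₁)) + sum (w last ∷ []) + 1
      ≡⟨ cong (_+ 1) (sum-++ (tabulate (w ∘ inject₁)) (w last ∷ [])) ⟨
    sum (tabulate (w ∘ inject₁) ++ w last ∷ []) + 1
      ≡⟨ cong (λ xs → sum xs + 1) (tabulate-init-last n w) ⟨
    sum (tabulate w) + 1
      ≡⟨ cong (_+ 1) Σe≡d-1 ⟩
    d ∸ 1 + 1
      ≡⟨ m∸n+n≡m d≥1 ⟩
    d ∎
    where
    open ≡-Reasoning
    w : Fin (suc n) → ℕ
    w j = e j ∸ 1

  reaches-last-injective : ∀ {x y} → Fixed rep x → Fixed rep y →
                           proj₁ (reaches-last x) ≡ proj₁ (reaches-last y) → x ≡ y
  reaches-last-injective {x} {y} rx≡x ry≡y eq = begin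
    x                            ≡⟨ rx≡x ⟨
    rep x                        ≡⟨ Conn⇒rep≡ (proj₂ (proj₂ (reaches-last x))) ⟩
    rep (proj₁ (reaches-last x)) ≡⟨ cong rep eq ⟩
    rep (proj₁ (reaches-last y)) ≡⟨ Conn⇒rep≡ (proj₂ (proj₂ (reaches-last y))) ⟨
    rep y                        ≡⟨ ry≡y ⟩
    y                            ∎
    where open ≡-Reasoning

  count≤representatives+excess : ∀ {U : Pred (Fin d) 0ℓ} (U? : Decidable U) →
    (∀ {x y} → x ≈ y → U x → U y) →
    count U? ≤ count (fixed? rep ∩? U?) + sum (map excess (filter (U? ∘ base) nonLast))
  count≤representatives+excess U? U-resp = ≤-trans
    (≤-reflexive (count-≐ U? (fixed? (λ x → x) ∩? U?) ((refl ,_) , proj₂)))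
    (count-mergeAll U? U-resp (λ x → x) nonLast-connected (λ _ → refl) (λ _ → ε))

  LabelStructure : Fin d → ℕ → List (Fin (suc n)) → Set
  LabelStructure ν m L =
      (∀ x → PV (Q ν) x → app π x ≡ app γ x)
    × IsCycleOn m γ (PV (Q ν))
    × IsFactorization γ (map (λ j → σ j , e j) L)
    × SameGraph (Q ν) (FactGraph σ (λ j → j ∈ L) γ)
    × sum (map (λ j → e j ∸ 1) L) ≡ m ∸ 1
    where γ = prodL (map σ L)

  -- Items (i)–(iv) for the component of ν ∈ supp σ_last.
  ComponentStructure : Fin d → Set
  ComponentStructure ν =
      ((∀ j → ¬ SV (Q ν) j) × (∀ x → PV (Q ν) x ⇔ x ≡ ν) × app π ν ≡ ν)
    ⊎ Σ ℕ λ m → HasSize (PV (Q ν)) m × 2 ≤ m × (∃ λ j → SV (Q ν) j)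
              × (∀ L → Linked F._<_ L → (∀ j → (j ∈ L) ⇔ SV (Q ν) j) → LabelStructure ν m L)

  module Class (ν : Fin d) where

    InClass : Pred (Fin d) 0ℓ
    InClass x = rep x ≡ rep ν

    inClass? : Decidable InClass
    inClass? x = rep x ≟ rep ν

    ≈⇒InClass : ∀ {x} → ν ≈ x → InClass x
    ≈⇒InClass ν≈x = sym (Conn⇒rep≡ ν≈x)

    InClass⇒≈ : ∀ {x} → InClass x → ν ≈ x
    InClass⇒≈ eq = rep≡⇒≈ (sym eq)

    InClass-resp : ∀ {x y} → x ≈ y → InClass x → InClass y
    InClass-resp x≈y eq = trans (sym (Conn⇒rep≡ x≈y)) eq

    ∉Class-resp : ∀ {x y} → x ≈ y → ¬ InClass x → ¬ InClass y
    ∉Class-resp x≈y x∉ y∈ = x∉ (InClass-resp (≈-sym x≈y) y∈)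

    excess-inside excess-outside : ℕ
    excess-inside  = sum (map excess (filter (inClass? ∘ base) nonLast))
    excess-outside = sum (map excess (filter (∁? inClass? ∘ base) nonLast))

    count-inside : count inClass? ≤ 1 + excess-inside
    count-inside = ≤-trans (count≤representatives+excess inClass? InClass-resp)
                           (+-monoˡ-≤ excess-inside one-representative)
      where
      one-representative : count (fixed? rep ∩? inClass?) ≤ 1
      one-representative = ≤-trans
        (count-mono (fixed? rep ∩? inClass?) (_≟ rep ν) λ (rx≡x , rx≡rν) → trans (sym rx≡x) rx≡rν)
        (≤-reflexive (count-singleton (rep ν)))

    count-outside : count (∁? inClass?) ≤ count (supp? (σ last) ∩? ∁? inClass?) + excess-outside
    count-outside = ≤-trans (count≤representatives+excess (∁? inClass?) ∉Class-resp)
      (+-monoˡ-≤ excess-outside (count-injection (fixed? rep ∩? ∁? inClass?) (supp? (σ last) ∩? ∁? inClass?)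
                                  (λ {x} _ → proj₁ (reaches-last x)) reached-outside reach-injective))
      where
      reached-outside : ∀ {x} → (Fixed rep ∩ ∁ InClass) x → (Supp (σ last) ∩ ∁ InClass) (proj₁ (reaches-last x))
      reached-outside {x} (_ , x∉) = proj₁ (proj₂ (reaches-last x)) , ∉Class-resp (proj₂ (proj₂ (reaches-last x))) x∉
      reach-injective : ∀ {x y} → (Fixed rep ∩ ∁ InClass) x → (Fixed rep ∩ ∁ InClass) y →
                        proj₁ (reaches-last x) ≡ proj₁ (reaches-last y) → x ≡ y
      reach-injective (rx≡x , _) (ry≡y , _) = reaches-last-injective rx≡x ry≡y

    labels : List (Fin (suc n))
    labels = filter (inClass? ∘ base) nonLast

    SV⇒ : ∀ {j} → SV (Q ν) j → j ≢ last × ν ≈ base j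
    SV⇒ {j} ((_ , j≢last) , ν~j) = j≢last , ν~j ◅◅ (edge j≢last (base∈supp j) ◅ ε)

    ⇒SV : ∀ {j} → j ≢ last → ν ≈ base j → SV (Q ν) j
    ⇒SV {j} j≢last ν≈b = (tt , j≢last) , ν≈b ◅◅ (_◅_ {j = inj₁ j} (edge j≢last (base∈supp j)) ε)

    ∈labels⇒ : ∀ {j} → j ∈ labels → j ≢ last × InClass (base j)
    ∈labels⇒ j∈ = let j∈nonLast , b∈ = ∈-filter⁻ (inClass? ∘ base) {xs = nonLast} j∈ in
      All.lookup nonLast-≢ j∈nonLast , b∈

    ∈labels⇔SV : ∀ j → j ∈ labels ⇔ SV (Q ν) j
    ∈labels⇔SV j = mk⇔ (λ j∈ → ⇒SV (proj₁ (∈labels⇒ j∈)) (InClass⇒≈ (proj₂ (∈labels⇒ j∈))))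
                       (λ j∈Q → ∈-filter⁺ (inClass? ∘ base) (∈nonLast (proj₁ (SV⇒ j∈Q)))
                                                               (≈⇒InClass (proj₂ (SV⇒ j∈Q))))

    sorted-labels : ∀ {L} → Linked F._<_ L → (∀ j → j ∈ L ⇔ SV (Q ν) j) → L ≡ labels
    sorted-labels L-sorted L⇔ = sorted-unique FP.<-irrefl FP.<-asym
      (Linked⇒AllPairs FP.<-trans L-sorted) (AllPairsP.filter⁺ (inClass? ∘ base) nonLast-sorted)
      (λ j j∈L → Equivalence.from (∈labels⇔SV j) (Equivalence.to (L⇔ j) j∈L))
      (λ j j∈ → Equivalence.from (L⇔ j) (Equivalence.to (∈labels⇔SV j) j∈))

    σ-fixes-class : ∀ {j x} → j ≢ last → ¬ InClass (base j) → InClass x → app (σ j) x ≡ x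
    σ-fixes-class {j} j≢last b∉ x∈ = ¬Supp⇒fixed (σ j) λ x∈supp → b∉ (InClass-resp (≈-block j≢last x∈supp (base∈supp j)) x∈)

    prodL-on-class : ∀ {js x} → All (_≢ last) js → InClass x →
      app (prodL (map σ js)) x ≡ app (prodL (map σ (filter (inClass? ∘ base) js))) x
    prodL-on-class []                        _  = refl
    prodL-on-class {j ∷ js} (j≢last ∷ js≢) x∈ with inClass? (base j)
    ... | yes _ = cong (app (σ j)) (prodL-on-class js≢ x∈)
    ... | no b∉ = trans (σ-fixes-class j≢last b∉ (InClass-resp (≈-prodL js≢ _) x∈)) (prodL-on-class js≢ x∈)

    γ : Perm d
    γ = prodL (map σ labels)

    π≡γ-on-class : ∀ {x} → InClass x → app π x ≡ app γ x
    π≡γ-on-class {x} x∈ = trans (π≡prodL-nonLast x) (prodL-on-class nonLast-≢ x∈)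

    γ-fixes-off-class : ∀ {y} → ¬ InClass y → app γ y ≡ y
    γ-fixes-off-class {y} y∉ = prodL-fixes (map σ labels) (AllP.map⁺ (All.tabulate σ-fixes))
      where
      σ-fixes : ∀ {j} → j ∈ labels → app (σ j) y ≡ y
      σ-fixes {j} j∈ = let j≢last , b∈ = ∈labels⇒ j∈ in
        ¬Supp⇒fixed (σ j) λ y∈supp → y∉ (InClass-resp (≈-block j≢last (base∈supp j) y∈supp) b∈)

    iter-γ≡iter-π : ∀ i → iter γ i ν ≡ iter π i ν
    iter-γ≡iter-π zero    = refl
    iter-γ≡iter-π (suc i) = trans (cong (app γ) (iter-γ≡iter-π i))
                                  (sym (π≡γ-on-class (≈⇒InClass (≈-iter-π i ν))))

    module _ (ν∈ : Supp (σ last) ν) where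

      class-counts : count (supp? (σ last) ∩? inClass?) ≡ 1 × count inClass? ≡ 1 + excess-inside
      class-counts = counting-squeeze count-inside count-outside
                                      (count-pos (supp? (σ last) ∩? inClass?) (ν∈ , refl)) (begin
        count inClass? + count (∁? inClass?)   ≡⟨ count-complement inClass? ⟩
        d                                      ≡⟨ Σexcess-nonLast ⟨
        sum (map excess nonLast) + e last
          ≡⟨ cong₂ _+_ (sym (sum-filter-split (inClass? ∘ base) excess nonLast))
                       (trans (sym (count-supp last)) (count-split (supp? (σ last)) inClass?)) ⟩
        (excess-inside + excess-outside)
          + (count (supp? (σ last) ∩? inClass?) + count (supp? (σ last) ∩? ∁? inClass?)) ∎)
        where open ≡-Reasoning

      unique-last-point : ∀ {ν′} → Supp (σ last) ν′ → ν ≈ ν′ → ν′ ≡ ν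
      unique-last-point ν′∈ ν≈ν′ =
        count≤1⇒unique (supp? (σ last) ∩? inClass?) (≤-reflexive (proj₁ class-counts)) (ν′∈ , ≈⇒InClass ν≈ν′) (ν∈ , refl)

      m : ℕ
      m = proj₁ (period π ν)

      per : IsPeriod π ν m
      per = proj₂ (period π ν)

      open IsPeriod per

      -- Iterating π from x reaches supp σ_last, and by uniqueness it does so at ν.
      class⊆orbit : ∀ {x} → ν ≈ x → InOrbit π per x
      class⊆orbit {x} ν≈x = let k , πᵏx∈ = π-reaches-last x in
        InOrbit-iter⁻ π per k (0 , positive , unique-last-point πᵏx∈ (ν≈x ◅◅ ≈-iter-π k x))

      PV⇔InClass : ∀ {x} → PV (Q ν) x ⇔ InClass x
      PV⇔InClass {x} = mk⇔ (≈⇒InClass ∘ proj₂) λ x∈ → τ-full x , InClass⇒≈ x∈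

      PV-HasSize : HasSize (PV (Q ν)) m
      PV-HasSize = orbit-HasSize m π ν (λ _ _ → period-distinct π per)
        (λ i _ → τ-full _ , ≈-iter-π i ν) (λ y (_ , ν≈y) → class⊆orbit ν≈y)

      count-class : count inClass? ≡ m
      count-class = count-HasSize inClass? (orbit-HasSize m π ν (λ _ _ → period-distinct π per)
        (λ i _ → ≈⇒InClass (≈-iter-π i ν)) (λ y y∈ → class⊆orbit (InClass⇒≈ y∈)))

      fixed-component : m ≡ 1 → (∀ j → ¬ SV (Q ν) j) × (∀ x → PV (Q ν) x ⇔ x ≡ ν) × app π ν ≡ ν
      fixed-component m≡1 = no-label , (λ x → mk⇔ (only-ν ∘ proj₂) λ { refl → τ-full ν , ε })
                          , subst (λ k → iter π k ν ≡ ν) m≡1 returns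
        where
        only-ν : ∀ {x} → ν ≈ x → x ≡ ν
        only-ν ν≈x = let i , i<m , x≡πⁱν = class⊆orbit ν≈x in
          trans x≡πⁱν (cong (λ k → iter π k ν) (n<1⇒n≡0 (subst (i <_) m≡1 i<m)))
        no-label : ∀ j → ¬ SV (Q ν) j
        no-label j j∈Q = let j≢last , ν≈b = SV⇒ j∈Q in
          base∈supp j (trans (only-ν (ν≈b ◅◅ ≈-σ j≢last (base j))) (sym (only-ν ν≈b)))

      module _ (m≥2 : 2 ≤ m) where

        πν≢ν : app π ν ≢ ν
        πν≢ν = minimal (s≤s z≤n) m≥2

        π-moves-class : ∀ {y} → InClass y → app π y ≢ y
        π-moves-class {y} y∈ πy≡y = let i , _ , y≡πⁱν = class⊆orbit (InClass⇒≈ y∈) in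
          πν≢ν (iter-injective π i (trans (sym (iter-suc-app π i ν)) (subst (λ z → app π z ≡ z) y≡πⁱν πy≡y)))

        Supp-γ⇔InClass : ∀ {y} → Supp γ y ⇔ InClass y
        Supp-γ⇔InClass {y} = mk⇔ (λ y∈ → decidable-stable (inClass? y) (y∈ ∘ γ-fixes-off-class))
                                 (λ y∈ γy≡y → π-moves-class y∈ (trans (π≡γ-on-class y∈) γy≡y))

        some-label : ∃ λ j → SV (Q ν) j
        some-label = first-label πν≢ν (≈-π ν)
          where
          first-label : ∀ {x} → x ≢ ν → ν ≈ x → ∃ λ j → SV (Q ν) j
          first-label x≢ν ε                      = contradiction refl x≢ν
          first-label _   (_◅_ {j = inj₁ j} a _) = j , (tt , proj₂ a) , a ◅ ε

        γ-cycle : IsCycleOn m γ (PV (Q ν))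
        γ-cycle = ν , (τ-full ν , ε) , trans (iter-γ≡iter-π m) returns
                , (λ i j i<j j<m eq → period-distinct π per i<j j<m
                                        (trans (sym (iter-γ≡iter-π i)) (trans eq (iter-γ≡iter-π j))))
                , (λ i _ → subst (PV (Q ν)) (sym (iter-γ≡iter-π i)) (τ-full _ , ≈-iter-π i ν))
                , (λ y (_ , ν≈y) → let i , i<m , y≡πⁱν = class⊆orbit ν≈y in
                                   i , i<m , trans y≡πⁱν (sym (iter-γ≡iter-π i)))
                , (λ y y∉ → γ-fixes-off-class (y∉ ∘ Equivalence.from PV⇔InClass))

        γ-factorization : IsFactorization γ (map (λ j → σ j , e j) labels)
        γ-factorization = AllP.map⁺ (All.tabulate factor) , λ x → cong (λ σs → app (prodL σs) x) (sym (map-∘ labels))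
          where
          factor : ∀ {j} → j ∈ labels → IsECycle (e j) (σ j) × (∀ y → Supp (σ j) y → Supp γ y)
          factor {j} j∈ = let j≢last , b∈ = ∈labels⇒ j∈ in σ-cycle j ,
            λ y y∈supp → Equivalence.from Supp-γ⇔InClass (InClass-resp (≈-block j≢last (base∈supp j) y∈supp) b∈)

        γ-graph : SameGraph (Q ν) (FactGraph σ (_∈ labels) γ)
        γ-graph = (λ j → ⇔.sym (∈labels⇔SV j))
                , (λ x → ⇔.trans PV⇔InClass (⇔.sym Supp-γ⇔InClass))
                , λ j x → mk⇔
                    (λ (((_ , x∈supp) , j≢last) , ν~j , _) →
                       Equivalence.from (∈labels⇔SV j) ((tt , j≢last) , ν~j) , x∈supp)
                    (λ (j∈ , x∈supp) → let j≢last , b∈ = ∈labels⇒ j∈ ; _ , ν~j = ⇒SV j≢last (InClass⇒≈ b∈) in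
                       ((tt , x∈supp) , j≢last) , ν~j , ν~j ◅◅ (edge j≢last x∈supp ◅ ε))

        Σlabels : sum (map (λ j → e j ∸ 1) labels) ≡ m ∸ 1
        Σlabels = begin
          sum (map (λ j → e j ∸ 1) labels) ≡⟨ cong sum (map-cong excess≡e-1 labels) ⟨
          excess-inside                    ≡⟨ cong (_∸ 1) (proj₂ class-counts) ⟨
          count inClass? ∸ 1               ≡⟨ cong (_∸ 1) count-class ⟩
          m ∸ 1                            ∎
          where open ≡-Reasoning

      component-structure : ComponentStructure ν
      component-structure with m≤n⇒m<n∨m≡n positive
      ... | inj₂ 1≡m = inj₁ (fixed-component (sym 1≡m))
      ... | inj₁ m≥2 = inj₂ (m , PV-HasSize , m≥2 , some-label m≥2 ,
                             λ L L-sorted L⇔ → for-labels (sorted-labels L-sorted L⇔))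
        where
        for-labels : ∀ {L} → L ≡ labels → LabelStructure ν m L
        for-labels refl = (λ x x∈ → π≡γ-on-class (Equivalence.to PV⇔InClass x∈)) , γ-cycle m≥2
                        , γ-factorization m≥2 , γ-graph m≥2 , Σlabels m≥2

  vertex-reaches-last : ∀ v → Vtx G′ v → ∃ λ ν → Supp (σ last) ν × Conn G′ (inj₂ ν) v
  vertex-reaches-last (inj₂ x) _ = let ν , ν∈ , x≈ν = reaches-last x in ν , ν∈ , ≈-sym x≈ν
  vertex-reaches-last (inj₁ j) (_ , j≢last) = let ν , ν∈ , b≈ν = reaches-last (base j) in
    ν , ν∈ , ≈-sym b≈ν ◅◅ (edge j≢last (base∈supp j) ◅ ε)

  label-reaches-last : ∀ (j : Fin n) → ∃ λ ν → Supp (σ last) ν × SV (Q ν) (inject₁ j)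
  label-reaches-last j = let ν , ν∈ , ν~j = vertex-reaches-last (inj₁ (inject₁ j)) (tt , inject₁≢last j) in
    ν , ν∈ , (tt , inject₁≢last j) , ν~j

  last-points-separated : ∀ ν ν′ → Supp (σ last) ν → Supp (σ last) ν′ → ν ≈ ν′ → ν ≡ ν′
  last-points-separated ν ν′ ν∈ ν′∈ ν≈ν′ = sym (Class.unique-last-point ν ν∈ ν′∈ ν≈ν′)

  label-determines-component : ∀ j ν ν′ → Supp (σ last) ν → Supp (σ last) ν′ →
                               SV (Q ν) j → SV (Q ν′) j → ν ≡ ν′
  label-determines-component j ν ν′ ν∈ ν′∈ (_ , ν~j) (_ , ν′~j) =
    last-points-separated ν ν′ ν∈ ν′∈ (ν~j ◅◅ Conn-sym ν′~j)

lemma3p9 : (d n : ℕ) → 1 ≤ d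
  → (e : Fin (suc n) → ℕ) → (∀ j → 2 ≤ e j)
  → sum (tabulate (λ j → e j ∸ 1)) ≡ d ∸ 1
  → (τ : Perm d) → IsECycle d τ
  → (σ : Fin (suc n) → Perm d)
  → IsFactorization τ (tabulate (λ j → σ j , e j))
  → let last = fromℕ n
        G = FactGraph σ (λ _ → ⊤) τ
        G' = DeleteLabel G last
        Q = λ (ν : Fin d) → Component G' (inj₂ ν)
        π = prodL (tabulate (λ (j : Fin n) → σ (inject₁ j)))
    in
      (∀ v → Vtx G' v → ∃ λ ν → Supp (σ last) ν × Conn G' (inj₂ ν) v)
    × (∀ ν ν' → Supp (σ last) ν → Supp (σ last) ν'
         → Conn G' (inj₂ ν) (inj₂ ν') → ν ≡ ν')
    × (∀ (j : Fin n) → ∃ λ ν → Supp (σ last) ν × SV (Q ν) (inject₁ j))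
    × (∀ j ν ν' → Supp (σ last) ν → Supp (σ last) ν'
         → SV (Q ν) j → SV (Q ν') j → ν ≡ ν')
    × (∀ x → app π x ≡ app τ (appInv (σ last) x))
    × (∀ ν → Supp (σ last) ν →
          ( (∀ j → ¬ SV (Q ν) j)
          × (∀ x → PV (Q ν) x ⇔ x ≡ ν)
          × app π ν ≡ ν )
        ⊎ Σ ℕ λ m →
            HasSize (PV (Q ν)) m
          × 2 ≤ m
          × (∃ λ j → SV (Q ν) j)
          × (∀ (L : List (Fin (suc n))) → Linked F._<_ L
               → (∀ j → (j ∈ L) ⇔ SV (Q ν) j)
               → let γ = prodL (map σ L) in
                   (∀ x → PV (Q ν) x → app π x ≡ app γ x)
                 × IsCycleOn m γ (PV (Q ν))
                 × IsFactorization γ (map (λ j → σ j , e j) L)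
                 × SameGraph (Q ν) (FactGraph σ (λ j → j ∈ L) γ)
                 × sum (map (λ j → e j ∸ 1) L) ≡ m ∸ 1))
lemma3p9 d n d≥1 e e≥2 Σe≡d-1 τ τ-cycle σ factorization =
    vertex-reaches-last
  , last-points-separated
  , label-reaches-last
  , label-determines-component
  , π≡τ∘σlast⁻¹
  , Class.component-structure
  where open LastFactorDeleted d n d≥1 e e≥2 Σe≡d-1 τ τ-cycle σ factorization
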